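{- The reduction pair induced by $\mathrm{WPO}(\mathcal A_{\mathrm{mat}})$ with the refinements (2c) and (2d) subsumes the reduction pair induced by the matrix interpretation $\mathcal A_{\mathrm{mat}}$: for every matrix interpretation $\mathcal A_{\mathrm{mat}}$ there exist a quasi-precedence and a partial status $\sigma$ such that $\mathcal A_{\mathrm{mat}}$ is weakly simple w.r.t. $\sigma$ and the refined WPO pair induced by $\mathcal A_{\mathrm{mat}}$ satisfies $(\succsim_{\mathrm{WPO}},\succ_{\mathrm{WPO}})=(\geq_{\mathcal A_{\mathrm{mat}}},>_{\mathcal A_{\mathrm{mat}}})$.
   Context: Terms over a finite signature $\Sigma$ and variables $\mathcal V$. Matrix interpretation of dimension $d\ge1$: carrier $\mathbb N^d$; $v\geq u$ iff $v_j\ge u_j$ for all $j$; $v>u$ iff $v_1>u_1$ and $v_j\ge u_j$ for $j=2..d$; $f_{\mathcal A}(\vec x_1..\vec x_n)=\vec w(f)+\sum_i M(f,i)\vec x_i$ with $\vec w(f)\in\mathbb N^d$ and $d\times d$ natural matrices $M(f,i)$. On terms $s\geq_{\mathcal A}t$ ($>_{\mathcal A}$) iff $\hat\alpha(s)\geq\hat\alpha(t)$ ($>$) for all assignments. A partial status $\sigma$ assigns to each $f\in\Sigma_n$ a list of distinct positions in $\{1..n\}$ (also a set); $\sigma(f)(s_1..s_n)$ is the list of arguments at those positions. $\mathcal A$ is weakly (strictly) simple w.r.t. $\sigma$ iff $f_{\mathcal A}(\dots,a_i,\dots)\geq a_i$ ($>a_i$) for all $f$, $i\in\sigma(f)$.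 Quasi-precedence: quasi-order $\succsim$ on $\Sigma$ with well-founded strict part $\succ$, equivalence $\sim$. Lex for a pair $(\succsim',\succ')$: $[s_1..s_n]\succsim'^{\mathrm{lex}}[t_1..t_m]$ iff there is $k\le n$ with $s_i\succsim' t_i$ ($i\le k$) and either $k=m$ or ($k<\min(n,m)$ and $s_{k+1}\succ' t_{k+1}$); $\succ'^{\mathrm{lex}}$ likewise but with $k<n$ required when $k=m$. Refined WPO pair: $x\succsim_W x$ for variables; for $s=f(s_1..s_n)$, $s\succsim_W t$ (resp. $\succ_W$) iff (1) $s>_{\mathcal A}t$, or (2) $s\geq_{\mathcal A}t$ and (a) $s_i\succsim_W t$ for some $i\in\sigma(f)$, or (b) $t=g(t_1..t_m)$, $s\succ_W t_j$ for all $j\in\sigma(g)$, and $f\succ g$ or ($f\sim g$ and $\sigma(f)(\vec s)\succsim_W^{\mathrm{lex}}\sigma(g)(\vec t)$, resp. $\succ_W^{\mathrm{lex}}$). Additionally $s\succsim_W t$ if $s\geq_{\mathcal A}t$ and (2c) $s\in\mathcal V$, $t=g(t_1..t_m)$, $\sigma(g)=[\,]$, $f\succsim g$ for all $f$; or (2d) (only when $\mathcal A$ is strictly simple w.r.t. $\sigma$) $s=f(s_1..s_n)$, $t\in\mathcal V$, and for all $g$: $f\succ g$ or ($f\succsim g$ and $\sigma(g)=[\,]$). Nothing else is related. -}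

module Defs where

open import Level using (0ℓ)
open import Data.Nat using (ℕ; zero; suc; _+_; _*_; _≤_; _<_)
open import Data.Fin using (Fin; zero; suc)
open import Data.Vec using (Vec; []; _∷_; lookup)
open import Data.List using (List; []; _∷_; map)
open import Data.List.Membership.Propositional using (_∈_)
open import Data.List.Relation.Unary.Unique.Propositional using (Unique)
open import Data.Product using (_×_; Σ)
open import Data.Sum using (_⊎_)
open import Relation.Nullary using (¬_)
open import Relation.Binary.PropositionalEquality using (_≡_)
open import Induction.WellFounded using (WellFounded)

record Signature : Set where
  field
    nsym  : ℕ
    arity : Fin nsym → ℕ
open Signature public

module _ (Sg : Signature) where

  Sym : Set
  Sym = Fin (nsym Sg)

  data Term : Set where
    var : ℕ → Term
    fun : (f : Sym) → Vec Term (arity Sg f) → Term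

sumF : (n : ℕ) → (Fin n → ℕ) → ℕ
sumF zero    g = 0
sumF (suc n) g = g zero + sumF n (λ i → g (suc i))

Carrier : ℕ → Set
Carrier d = Fin d → ℕ

Matrix : ℕ → Set
Matrix d = Fin d → Fin d → ℕ

_·ᵥ_ : ∀ {d} → Matrix d → Carrier d → Carrier d
_·ᵥ_ {d} M v j = sumF d (λ k → M j k * v k)

_≥ᵥ_ : ∀ {d} → Carrier d → Carrier d → Set
v ≥ᵥ u = ∀ j → u j ≤ v j

_>ᵥ_ : ∀ {e} → Carrier (suc e) → Carrier (suc e) → Set
v >ᵥ u = (u zero < v zero) × (∀ j → u (suc j) ≤ v (suc j))

record MatrixInterp (Sg : Signature) (e : ℕ) : Set where
  field
    w   : Sym Sg → Carrier (suc e)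
    M   : (f : Sym Sg) → Fin (arity Sg f) → Matrix (suc e)

module MatSem {Sg : Signature} {e : ℕ} (A : MatrixInterp Sg e) where
  open MatrixInterp A

  D : Set
  D = Carrier (suc e)

  interp : (f : Sym Sg) → Vec D (arity Sg f) → D
  interp f xs j = w f j + sumF (arity Sg f) (λ i → (M f i ·ᵥ lookup xs i) j)

  Assignment : Set
  Assignment = ℕ → D

  mutual
    eval : Assignment → Term Sg → D
    eval α (var x)    = α x
    eval α (fun f ts) = interp f (evalArgs α ts)

    evalArgs : ∀ {n} → Assignment → Vec (Term Sg) n → Vec D n
    evalArgs α []       = []
    evalArgs α (t ∷ ts) = eval α t ∷ evalArgs α ts

  _≥A_ : Term Sg → Term Sg → Set
  s ≥A t = ∀ (α : Assignment) → eval α s ≥ᵥ eval α t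

  _>A_ : Term Sg → Term Sg → Set
  s >A t = ∀ (α : Assignment) → eval α s >ᵥ eval α t

record PartialStatus (Sg : Signature) : Set where
  field
    pos    : (f : Sym Sg) → List (Fin (arity Sg f))
    unique : (f : Sym Sg) → Unique (pos f)
open PartialStatus public

applyStatus : ∀ {Sg} (σ : PartialStatus Sg) (f : Sym Sg) →
              Vec (Term Sg) (arity Sg f) → List (Term Sg)
applyStatus σ f ss = map (lookup ss) (pos σ f)

module Simple {Sg : Signature} {e : ℕ} (A : MatrixInterp Sg e) (σ : PartialStatus Sg) where
  open MatSem A

  WeaklySimple : Set
  WeaklySimple = ∀ (f : Sym Sg) (xs : Vec D (arity Sg f)) (i : Fin (arity Sg f)) →
                 i ∈ pos σ f → interp f xs ≥ᵥ lookup xs i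

  StrictlySimple : Set
  StrictlySimple = ∀ (f : Sym Sg) (xs : Vec D (arity Sg f)) (i : Fin (arity Sg f)) →
                   i ∈ pos σ f → interp f xs >ᵥ lookup xs i

record QuasiPrecedence (Sg : Signature) : Set₁ where
  field
    _≿_   : Sym Sg → Sym Sg → Set
    refl≿  : ∀ f → f ≿ f
    trans≿ : ∀ {f g h} → f ≿ g → g ≿ h → f ≿ h

  _≻_ : Sym Sg → Sym Sg → Set
  f ≻ g = f ≿ g × ¬ (g ≿ f)

  _∼_ : Sym Sg → Sym Sg → Set
  f ∼ g = f ≿ g × g ≿ f

  field
    wf≻ : WellFounded _≻_

module WPO {Sg : Signature} {e : ℕ} (A : MatrixInterp Sg e)
           (prec : QuasiPrecedence Sg) (σ : PartialStatus Sg) where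
  open MatSem A
  open Simple A σ
  open QuasiPrecedence prec

  mutual
    data _≿W_ : Term Sg → Term Sg → Set where
      var-refl : ∀ x → var x ≿W var x
      ge1  : ∀ {f ss t} → fun f ss >A t → fun f ss ≿W t
      ge2a : ∀ {f ss t} → fun f ss ≥A t →
             (i : Fin (arity Sg f)) → i ∈ pos σ f → lookup ss i ≿W t →
             fun f ss ≿W t
      ge2b : ∀ {f ss g ts} → fun f ss ≥A fun g ts →
             (∀ j → j ∈ pos σ g → fun f ss ≻W lookup ts j) →
             (f ≻ g ⊎ (f ∼ g × LexGe (applyStatus σ f ss) (applyStatus σ g ts))) →
             fun f ss ≿W fun g ts
      ge2c : ∀ {x g ts} → var x ≥A fun g ts →
             pos σ g ≡ [] → (∀ f → f ≿ g) →
             var x ≿W fun g ts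
      ge2d : ∀ {f ss y} → StrictlySimple → fun f ss ≥A var y →
             (∀ g → f ≻ g ⊎ (f ≿ g × pos σ g ≡ [])) →
             fun f ss ≿W var y

    data _≻W_ : Term Sg → Term Sg → Set where
      gt1  : ∀ {f ss t} → fun f ss >A t → fun f ss ≻W t
      gt2a : ∀ {f ss t} → fun f ss ≥A t →
             (i : Fin (arity Sg f)) → i ∈ pos σ f → lookup ss i ≿W t →
             fun f ss ≻W t
      gt2b : ∀ {f ss g ts} → fun f ss ≥A fun g ts →
             (∀ j → j ∈ pos σ g → fun f ss ≻W lookup ts j) →
             (f ≻ g ⊎ (f ∼ g × LexGt (applyStatus σ f ss) (applyStatus σ g ts))) →
             fun f ss ≻W fun g ts

    data LexGe : List (Term Sg) → List (Term Sg) → Set where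
      ge-nil  : ∀ {ss} → LexGe ss []
      ge-this : ∀ {s t ss ts} → s ≻W t → LexGe (s ∷ ss) (t ∷ ts)
      ge-next : ∀ {s t ss ts} → s ≿W t → LexGe ss ts → LexGe (s ∷ ss) (t ∷ ts)

    data LexGt : List (Term Sg) → List (Term Sg) → Set where
      gt-nil  : ∀ {s ss} → LexGt (s ∷ ss) []
      gt-this : ∀ {s t ss ts} → s ≻W t → LexGt (s ∷ ss) (t ∷ ts)
      gt-next : ∀ {s t ss ts} → s ≿W t → LexGt ss ts → LexGt (s ∷ ss) (t ∷ ts)

-- With the empty status and the precedence identifying all symbols, rule (2a)
-- never applies and (2b) degenerates to s ≥_A t: the lexicographic comparison of
-- two empty lists holds weakly but never strictly.  The remaining pairs are
-- covered by (2c) and (2d) (the empty status makes A strictly simple) and by the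
-- facts that var x ≥_A var y forces x = y and that no variable is >_A-greater
-- than a term.
module Submission where

open import Defs
open import Data.Nat using (ℕ; zero; suc; _∸_; _≤_)
open import Data.Nat.Properties
  using (≤-refl; ≤-trans; ≤-reflexive; ≤-antisym; <⇒≤; n∸n≡0; n≤0⇒n≡0; m∸n≡0⇒m≤n)
open import Data.Product using (Σ; _×_; _,_; proj₁; proj₂)
open import Data.Sum using (inj₁; inj₂)
open import Data.Unit using (⊤; tt)
open import Data.Empty using (⊥-elim)
open import Data.Fin using (zero; suc)
open import Data.List using ([])
open import Data.List.Relation.Unary.AllPairs using ([])
open import Relation.Binary.PropositionalEquality using (_≡_; refl)
open import Relation.Nullary using (¬_)
open import Induction.WellFounded using (acc)
open import Function.Bundles using (_⇔_; mk⇔)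

flatPrecedence : (Sg : Signature) → QuasiPrecedence Sg
flatPrecedence Sg = record
  { _≿_    = λ _ _ → ⊤
  ; refl≿  = λ _ → tt
  ; trans≿ = λ _ _ → tt
  ; wf≻    = λ _ → acc λ { (_ , g⋡f) → ⊥-elim (g⋡f tt) }
  }

emptyStatus : (Sg : Signature) → PartialStatus Sg
emptyStatus Sg = record { pos = λ _ → [] ; unique = λ _ → [] }

module _ {Sg : Signature} {e : ℕ} (A : MatrixInterp Sg e) where
  open MatSem A
  open Simple A (emptyStatus Sg)

  emptyStatus-weaklySimple : WeaklySimple
  emptyStatus-weaklySimple _ _ _ ()

  emptyStatus-strictlySimple : StrictlySimple
  emptyStatus-strictlySimple _ _ _ ()

  ≥A-refl : ∀ t → t ≥A t
  ≥A-refl _ _ _ = ≤-refl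

  >A⇒≥A : ∀ {s t} → s >A t → s ≥A t
  >A⇒≥A s>t α zero    = <⇒≤ (proj₁ (s>t α))
  >A⇒≥A s>t α (suc j) = proj₂ (s>t α) j

  -- Evaluate under z ↦ z and under z ↦ x ∸ z to get y ≤ x and x ∸ y ≤ 0.
  var-≥A⇒≡ : ∀ {x y} → var x ≥A var y → x ≡ y
  var-≥A⇒≡ {x} {y} x≥y = ≤-antisym x≤y (x≥y (λ z _ → z) zero)
    where
    x∸y≤0 : x ∸ y ≤ 0
    x∸y≤0 = ≤-trans (x≥y (λ z _ → x ∸ z) zero) (≤-reflexive (n∸n≡0 x))

    x≤y : x ≤ y
    x≤y = m∸n≡0⇒m≤n (n≤0⇒n≡0 x∸y≤0)

  var-≯A : ∀ {x t} → ¬ (var x >A t)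
  var-≯A x>t with proj₁ (x>t (λ _ _ → 0))
  ... | ()

module FlatWPO {Sg : Signature} {e : ℕ} (A : MatrixInterp Sg e) where
  open MatSem A
  open WPO A (flatPrecedence Sg) (emptyStatus Sg)

  ≿W⇒≥A : ∀ s t → s ≿W t → s ≥A t
  ≿W⇒≥A _ _ (var-refl x)  = ≥A-refl A (var x)
  ≿W⇒≥A s t (ge1 s>t)     = >A⇒≥A A {s} {t} s>t
  ≿W⇒≥A _ _ (ge2a _ _ () _)
  ≿W⇒≥A _ _ (ge2b s≥t _ _) = s≥t
  ≿W⇒≥A _ _ (ge2c s≥t _ _) = s≥t
  ≿W⇒≥A _ _ (ge2d _ s≥t _) = s≥t

  ≥A⇒≿W : ∀ s t → s ≥A t → s ≿W t
  ≥A⇒≿W (var x)    (var y)    x≥y with var-≥A⇒≡ A x≥y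
  ... | refl = var-refl x
  ≥A⇒≿W (var x)    (fun g ts) s≥t = ge2c s≥t refl (λ _ → tt)
  ≥A⇒≿W (fun f ss) (var y)    s≥t =
    ge2d (emptyStatus-strictlySimple A) s≥t (λ _ → inj₂ (tt , refl))
  ≥A⇒≿W (fun f ss) (fun g ts) s≥t = ge2b s≥t (λ _ ()) (inj₂ ((tt , tt) , ge-nil))

  -- f ≻ g is unsatisfiable in the flat precedence and LexGt [] [] is empty.
  ≻W⇒>A : ∀ s t → s ≻W t → s >A t
  ≻W⇒>A _ _ (gt1 s>t)       = s>t
  ≻W⇒>A _ _ (gt2a _ _ () _)
  ≻W⇒>A _ _ (gt2b _ _ (inj₁ (_ , g⋡f))) = ⊥-elim (g⋡f tt)
  ≻W⇒>A _ _ (gt2b _ _ (inj₂ (_ , ())))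

  >A⇒≻W : ∀ s t → s >A t → s ≻W t
  >A⇒≻W (var x)    t x>t = ⊥-elim (var-≯A A {x} {t} x>t)
  >A⇒≻W (fun f ss) t s>t = gt1 s>t

corollary7 : (Sg : Signature) (e : ℕ) (A : MatrixInterp Sg e) →
    Σ (QuasiPrecedence Sg) λ prec → Σ (PartialStatus Sg) λ σ →
    Simple.WeaklySimple A σ
    × (∀ s t → WPO._≿W_ A prec σ s t ⇔ MatSem._≥A_ A s t)
    × (∀ s t → WPO._≻W_ A prec σ s t ⇔ MatSem._>A_ A s t)
corollary7 Sg e A =
  flatPrecedence Sg , emptyStatus Sg , emptyStatus-weaklySimple A
  , (λ s t → mk⇔ (≿W⇒≥A s t) (≥A⇒≿W s t))
  , (λ s t → mk⇔ (≻W⇒>A s t) (>A⇒≻W s t))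
  where open FlatWPO A
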